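{- As $n\to\infty$ (with $n\ge 3$), $\mu(L(K_n))=\left(\frac{2}{3}+o(1)\right)\frac{n^2}{2}$.
   Context: $L(K_n)$ is the line graph of the complete graph $K_n$ (vertices are the edges of $K_n$, adjacent iff they share an endpoint). For a connected graph $H$ and $X\subseteq V(H)$, two vertices are $X$-visible if there is a shortest path between them whose internal vertices are not in $X$; $X$ is a mutual-visibility set if every two vertices of $X$ are $X$-visible, and $\mu(H)$ is the maximum cardinality of a mutual-visibility set of $H$. -}

module Defs where

open import Level using (Level)
open import Data.Nat using (ℕ; zero; suc; _+_; _<_)
open import Data.Fin using (Fin; toℕ)
open import Data.Product using (Σ; _×_; _,_; ∃-syntax)
open import Data.Sum using (_⊎_)
open import Data.List using (List; []; _∷_; length)
open import Data.List.Membership.Propositional using (_∈_; _∉_)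
open import Data.List.Relation.Unary.All using (All)
open import Data.List.Relation.Unary.Unique.Propositional using (Unique)
open import Relation.Binary.PropositionalEquality using (_≡_; _≢_)

module Graph {V : Set} (Adj : V → V → Set) where

  data Walk : V → V → Set where
    nil  : ∀ {u} → Walk u u
    cons : ∀ {u w v} → Adj u w → Walk w v → Walk u v

  len : ∀ {u v} → Walk u v → ℕ
  len nil        = zero
  len (cons _ p) = suc (len p)

  initVerts : ∀ {u v} → Walk u v → List V
  initVerts nil                = []
  initVerts (cons {u = u} _ p) = u ∷ initVerts p

  internal : ∀ {u v} → Walk u v → List V
  internal nil        = []
  internal (cons _ p) = initVerts p

  IsShortest : ∀ {u v} → Walk u v → Set
  IsShortest {u} {v} p = ∀ (q : Walk u v) → len p Data.Nat.≤ len q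

  Visible : List V → V → V → Set
  Visible X x y = ∃[ p ] (IsShortest {x} {y} p × All (_∉ X) (internal p))

  -- X (a list without repetitions, i.e. a finite vertex set) is a
  -- mutual-visibility set
  MutualVisibility : List V → Set
  MutualVisibility X = Unique X × (∀ {x y} → x ∈ X → y ∈ X → Visible X x y)

-- The line graph L(K_n): vertices are edges {i,j} of K_n, encoded as
-- pairs (i , j) with i < j; two distinct edges are adjacent iff they
-- share an endpoint.

LKVertex : ℕ → Set
LKVertex n = Σ (Fin n × Fin n) (λ { (i , j) → toℕ i < toℕ j })

LKAdj : ∀ n → LKVertex n → LKVertex n → Set
LKAdj n ((a , b) , _) ((c , d) , _) =
  ((a , b) ≢ (c , d)) × ((a ≡ c) ⊎ (a ≡ d) ⊎ (b ≡ c) ⊎ (b ≡ d))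

MutVisLK : (n : ℕ) → List (LKVertex n) → Set
MutVisLK n = Graph.MutualVisibility (LKAdj n)

-- Read a mutual-visibility set X of L(K n) as the edge set of a graph on the n
-- vertices of K n. This graph is K₄-free: if ab, cd ∈ X were opposite edges of a K₄, a shortest
-- ab,cd-path has length 2 and its middle vertex joins an endpoint of ab to one of cd, i.e. it is
-- one of ac, ad, bc, bd ∈ X. Turán's theorem for K₄ then gives 3 · 2|X| ≤ 2 n²; it is proved by
-- induction, splitting off a maximal clique C (|C| ≤ 3), each vertex outside C missing a vertex of C.
--
-- Colour the vertices of K n by their residues mod 3 and let X be the bichromatic
-- edges, at least (n² − n)/3 of them. Two disjoint edges of X have four endpoints but only three
-- colours, so some endpoint of one has the colour of some endpoint of the other; the monochromatic
-- edge joining these is outside X and is the middle of a shortest path between them.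

module Submission where

open import Defs
open import Data.Nat using (ℕ; _+_; _*_; _≤_)
open import Data.Product using (_×_; ∃-syntax)
open import Data.List using (length)

open import Data.Empty using (⊥; ⊥-elim)
open import Data.Fin.Base as Fin using (Fin; toℕ; fromℕ<)
open import Data.Fin.Properties using (toℕ-injective; toℕ-fromℕ<) renaming (_≟_ to _≟ᶠ_)
open import Data.List.Base using (List; []; _∷_; map; filter; concatMap; _++_; allFin; downFrom)
open import Data.List.Membership.DecPropositional using (_∈?_)
open import Data.List.Membership.Propositional using (_∈_; _∉_; lose; find)
open import Data.List.Membership.Propositional.Properties
  using (∈-filter⁺; ∈-filter⁻; ∈-map⁺; ∈-map⁻; ∈-concatMap⁺; ∈-allFin)
open import Data.List.Properties
  using (filter-notAll; filter-some; length-map; length-++; length-tabulate; map-cong)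
open import Data.List.Relation.Binary.Disjoint.Propositional using (Disjoint)
open import Data.List.Relation.Binary.Subset.Propositional using (_⊆_)
open import Data.List.Relation.Unary.All as All using (All; []; _∷_)
import Data.List.Relation.Unary.All.Properties as All
open import Data.List.Relation.Unary.Any as Any using (Any; here; there)
open import Data.List.Relation.Unary.Unique.Propositional using (Unique; []; _∷_)
import Data.List.Relation.Unary.Unique.Propositional.Properties as Unique
open import Data.Nat.Base using (zero; suc; _<_; z≤n; s≤s; pred)
open import Data.Nat.Induction using (<-wellFounded)
open import Data.Nat.ListAction using (sum)
open import Data.Nat.Properties
open import Algebra.Properties.CommutativeSemigroup +-commutativeSemigroup
  using () renaming (interchange to +-interchange; x∙yz≈y∙xz to x+yz≡y+xz)
open import Data.Nat.Tactic.RingSolver using (solve-∀)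
open import Data.Product.Base using (_,_; proj₁; proj₂; ∃₂; swap; map₂)
import Data.Product.Properties as Product
open import Data.Sum.Base as Sum using (_⊎_; inj₁; inj₂)
open import Function.Base using (_∘_; id)
open import Induction.WellFounded using (Acc; acc)
open import Level using (0ℓ)
open import Relation.Binary.Core using (Rel)
import Relation.Binary.Definitions as Binary
open import Relation.Binary.Definitions using (DecidableEquality; Symmetric; tri<; tri≈; tri>)
open import Relation.Binary.PropositionalEquality
open import Relation.Nullary.Decidable using (Dec; yes; no; ¬?; _×-dec_; _⊎-dec_; map′)
open import Relation.Nullary.Negation using (¬_)
open import Relation.Unary using (Pred; Decidable; ∁)
open import Relation.Unary.Properties using (∁?)

private
  variable
    A B : Set

indicator : {P : Set} → Dec P → ℕ
indicator (yes _) = 1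
indicator (no _)  = 0

indicator-yes : {P : Set} (d : Dec P) → P → indicator d ≡ 1
indicator-yes (yes _) _ = refl
indicator-yes (no ¬p) p = ⊥-elim (¬p p)

indicator-no : {P : Set} (d : Dec P) → ¬ P → indicator d ≡ 0
indicator-no (yes p) ¬p = ⊥-elim (¬p p)
indicator-no (no _)  _  = refl

count : {P : Pred A 0ℓ} → Decidable P → List A → ℕ
count P? xs = sum (map (indicator ∘ P?) xs)

sum-map-+ : (f g : A → ℕ) (xs : List A) →
            sum (map (λ x → f x + g x) xs) ≡ sum (map f xs) + sum (map g xs)
sum-map-+ f g []       = refl
sum-map-+ f g (x ∷ xs) = begin
  f x + g x + sum (map (λ x → f x + g x) xs)    ≡⟨ cong (f x + g x +_) (sum-map-+ f g xs) ⟩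
  f x + g x + (sum (map f xs) + sum (map g xs)) ≡⟨ +-interchange (f x) (g x) _ _ ⟩
  f x + sum (map f xs) + (g x + sum (map g xs)) ∎
  where open ≡-Reasoning

sum-map-swap : (f : A → B → ℕ) (xs : List A) (ys : List B) →
               sum (map (λ x → sum (map (f x) ys)) xs) ≡ sum (map (λ y → sum (map (λ x → f x y) xs)) ys)
sum-map-swap f []       ys = sym (sum-map-zero ys)
  where
  sum-map-zero : (ys : List B) → sum (map (λ _ → 0) ys) ≡ 0
  sum-map-zero []       = refl
  sum-map-zero (_ ∷ ys) = sum-map-zero ys
sum-map-swap f (x ∷ xs) ys =
  trans (cong (sum (map (f x) ys) +_) (sum-map-swap f xs ys))
        (sym (sum-map-+ (f x) (λ y → sum (map (λ x → f x y) xs)) ys))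

sum-map-≤ : ∀ {f : A → ℕ} {k} {xs} → All (λ x → f x ≤ k) xs → sum (map f xs) ≤ length xs * k
sum-map-≤ []         = z≤n
sum-map-≤ (fx≤k ∷ p) = +-mono-≤ fx≤k (sum-map-≤ p)

module _ {P : Pred A 0ℓ} (P? : Decidable P) where

  sum-map-filter : (f : A → ℕ) (xs : List A) →
                   sum (map f xs) ≡ sum (map f (filter P? xs)) + sum (map f (filter (∁? P?) xs))
  sum-map-filter f [] = refl
  sum-map-filter f (x ∷ xs) with P? x
  ... | yes _ = trans (cong (f x +_) (sum-map-filter f xs)) (sym (+-assoc (f x) _ _))
  ... | no  _ = trans (cong (f x +_) (sum-map-filter f xs)) (x+yz≡y+xz (f x) (sum (map f (filter P? xs))) _)

  length-filter-∁ : (xs : List A) → length xs ≡ length (filter P? xs) + length (filter (∁? P?) xs)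
  length-filter-∁ [] = refl
  length-filter-∁ (x ∷ xs) with P? x
  ... | yes _ = cong suc (length-filter-∁ xs)
  ... | no  _ = trans (cong suc (length-filter-∁ xs)) (sym (+-suc _ _))

  count≡length-filter : (xs : List A) → count P? xs ≡ length (filter P? xs)
  count≡length-filter [] = refl
  count≡length-filter (x ∷ xs) with P? x
  ... | yes _ = cong suc (count≡length-filter xs)
  ... | no  _ = count≡length-filter xs

  count-< : ∀ {xs} → Any (∁ P) xs → count P? xs < length xs
  count-< {xs} ¬px = subst (_< length xs) (sym (count≡length-filter xs)) (filter-notAll P? xs ¬px)

unique-⊆⇒length≤ : DecidableEquality A → ∀ {xs ys : List A} → Unique xs → xs ⊆ ys → length xs ≤ length ys
unique-⊆⇒length≤ _≟_ {[]}     _               _      = z≤n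
unique-⊆⇒length≤ _≟_ {x ∷ xs} {ys} (x∉xs ∷ uxs) x∷xs⊆ys =
  <-≤-trans (s≤s (unique-⊆⇒length≤ _≟_ uxs xs⊆ys∖x)) (filter-notAll (λ y → ¬? (x ≟ y)) ys x∈ys)
  where
  x∈ys : Any (∁ (λ y → ¬ x ≡ y)) ys
  x∈ys = Any.map (λ x≡y x≢y → x≢y x≡y) (x∷xs⊆ys (here refl))
  xs⊆ys∖x : xs ⊆ filter (λ y → ¬? (x ≟ y)) ys
  xs⊆ys∖x v∈xs = ∈-filter⁺ (λ y → ¬? (x ≟ y)) (x∷xs⊆ys (there v∈xs)) (All.lookup x∉xs v∈xs)

module Degrees {V : Set} {E : Rel V 0ℓ} (E? : Binary.Decidable E) where

  degree : V → List V → ℕ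
  degree u T = count (E? u) T

  degreeSum : List V → List V → ℕ
  degreeSum W T = sum (map (λ w → degree w T) W)

  degreeSum-≤ : ∀ {W T} → All (λ w → Any (λ v → ¬ E w v) T) W → degreeSum W T ≤ length W * pred (length T)
  degreeSum-≤ nonAdjacent = sum-map-≤ (All.map (λ {w} ¬wv → pred-mono-≤ (count-< (E? w) ¬wv)) nonAdjacent)

  module _ (E-sym : Symmetric E) where

    degreeSum-comm : ∀ W T → degreeSum W T ≡ degreeSum T W
    degreeSum-comm W T = trans (sum-map-swap (λ w v → indicator (E? w v)) W T)
      (cong sum (map-cong (λ v → cong sum (map-cong (λ w → indicator-sym w v) W)) T))
      where
      indicator-sym : ∀ w v → indicator (E? w v) ≡ indicator (E? v w)
      indicator-sym w v with E? w v | E? v w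
      ... | yes _  | yes _  = refl
      ... | no  _  | no  _  = refl
      ... | yes wv | no ¬vw = ⊥-elim (¬vw (E-sym wv))
      ... | no ¬wv | yes vw = ⊥-elim (¬wv (E-sym vw))

    degreeSum-filter : ∀ {P : Pred V 0ℓ} (P? : Decidable P) S → let Sᴾ = filter P? S ; S∁ = filter (∁? P?) S in
                       degreeSum S S ≡ degreeSum Sᴾ Sᴾ + 2 * degreeSum S∁ Sᴾ + degreeSum S∁ S∁
    degreeSum-filter P? S = begin
      degreeSum S S
        ≡⟨ sum-map-filter P? (λ w → degree w S) S ⟩
      sum (map (λ w → degree w S) Sᴾ) + sum (map (λ w → degree w S) S∁)
        ≡⟨ cong₂ _+_ (split Sᴾ) (split S∁) ⟩
      (degreeSum Sᴾ Sᴾ + degreeSum Sᴾ S∁) + (degreeSum S∁ Sᴾ + degreeSum S∁ S∁)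
        ≡⟨ cong (λ e → degreeSum Sᴾ Sᴾ + e + (degreeSum S∁ Sᴾ + degreeSum S∁ S∁)) (degreeSum-comm Sᴾ S∁) ⟩
      (degreeSum Sᴾ Sᴾ + degreeSum S∁ Sᴾ) + (degreeSum S∁ Sᴾ + degreeSum S∁ S∁)
        ≡⟨ regroup (degreeSum Sᴾ Sᴾ) (degreeSum S∁ Sᴾ) (degreeSum S∁ S∁) ⟩
      degreeSum Sᴾ Sᴾ + 2 * degreeSum S∁ Sᴾ + degreeSum S∁ S∁ ∎
      where
      open ≡-Reasoning
      Sᴾ = filter P? S
      S∁ = filter (∁? P?) S
      split : ∀ W → sum (map (λ w → degree w S) W) ≡ degreeSum W Sᴾ + degreeSum W S∁
      split W = trans (cong sum (map-cong (λ w → sum-map-filter P? (indicator ∘ E? w) S) W))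
                      (sum-map-+ (λ w → degree w Sᴾ) (λ w → degree w S∁) W)
      regroup : ∀ a b c → a + b + (b + c) ≡ a + 2 * b + c
      regroup = solve-∀

  arcsFrom : List V → V → List (V × V)
  arcsFrom T w = map (w ,_) (filter (E? w) T)

  arcs : List V → List V → List (V × V)
  arcs W T = concatMap (arcsFrom T) W

  length-arcs : ∀ W T → length (arcs W T) ≡ degreeSum W T
  length-arcs []      T = refl
  length-arcs (w ∷ W) T = begin
    length (arcsFrom T w ++ arcs W T)          ≡⟨ length-++ (arcsFrom T w) ⟩
    length (arcsFrom T w) + length (arcs W T)  ≡⟨ cong₂ _+_ (length-map (w ,_) (filter (E? w) T))
                                                              (length-arcs W T) ⟩
    length (filter (E? w) T) + degreeSum W T   ≡⟨ cong (_+ degreeSum W T) (count≡length-filter (E? w) T) ⟨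
    degreeSum (w ∷ W) T                        ∎
    where open ≡-Reasoning

  ∈-arcs : ∀ {W T w v} → w ∈ W → v ∈ T → E w v → (w , v) ∈ arcs W T
  ∈-arcs {T = T} {w} w∈W v∈T wv = ∈-concatMap⁺ (arcsFrom T) (lose w∈W (∈-map⁺ (w ,_) (∈-filter⁺ (E? w) v∈T wv)))

  unique-arcs-length≤ : DecidableEquality V → ∀ {S L} → (∀ v → v ∈ S) → Unique L →
                        All (λ (u , v) → E u v) L → length L ≤ degreeSum S S
  unique-arcs-length≤ _≟_ {S} {L} complete uL adjacent = begin
    length L          ≤⟨ unique-⊆⇒length≤ (Product.≡-dec _≟_ _≟_) uL L⊆arcs ⟩
    length (arcs S S) ≡⟨ length-arcs S S ⟩
    degreeSum S S     ∎
    where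
    open ≤-Reasoning
    L⊆arcs : L ⊆ arcs S S
    L⊆arcs {u , v} uv∈L = ∈-arcs (complete u) (complete v) (All.lookup adjacent uv∈L)

-- 2 (t + r)² − (3 t (t − 1) + 6 r (t − 1) + 2 r²) = (3 − t) (t + 2 r)
clique-split-bound : ∀ t r → 1 ≤ t → t ≤ 3 →
                     3 * (t * pred t) + 6 * (r * pred t) + 2 * (r * r) ≤ 2 * ((t + r) * (t + r))
clique-split-bound 1 r _ _ = ≤-trans (m≤m+n _ (4 * r + 2)) (≤-reflexive (e r))
  where e : ∀ r → 3 * (1 * 0) + 6 * (r * 0) + 2 * (r * r) + (4 * r + 2) ≡ 2 * ((1 + r) * (1 + r))
        e = solve-∀
clique-split-bound 2 r _ _ = ≤-trans (m≤m+n _ (2 * r + 2)) (≤-reflexive (e r))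
  where e : ∀ r → 3 * (2 * 1) + 6 * (r * 1) + 2 * (r * r) + (2 * r + 2) ≡ 2 * ((2 + r) * (2 + r))
        e = solve-∀
clique-split-bound 3 r _ _ = ≤-reflexive (e r)
  where e : ∀ r → 3 * (3 * 2) + 6 * (r * 2) + 2 * (r * r) ≡ 2 * ((3 + r) * (3 + r))
        e = solve-∀
clique-split-bound (suc (suc (suc (suc _)))) _ _ (s≤s (s≤s (s≤s ())))

turán-step : ∀ {t r d x d′} → 1 ≤ t → t ≤ 3 → d ≤ t * pred t → x ≤ r * pred t → 3 * d′ ≤ 2 * (r * r) →
             3 * (d + 2 * x + d′) ≤ 2 * ((t + r) * (t + r))
turán-step {t} {r} {d} {x} {d′} 1≤t t≤3 d≤ x≤ d′≤ = begin
  3 * (d + 2 * x + d′)                              ≡⟨ distrib d x d′ ⟩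
  3 * d + 6 * x + 3 * d′                            ≤⟨ +-mono-≤ (+-mono-≤ (*-monoʳ-≤ 3 d≤) (*-monoʳ-≤ 6 x≤)) d′≤ ⟩
  3 * (t * pred t) + 6 * (r * pred t) + 2 * (r * r) ≤⟨ clique-split-bound t r 1≤t t≤3 ⟩
  2 * ((t + r) * (t + r))                           ∎
  where
  open ≤-Reasoning
  distrib : ∀ d x d′ → 3 * (d + 2 * x + d′) ≡ 3 * d + 6 * x + 3 * d′
  distrib = solve-∀

module Turán {V : Set} (_≟_ : DecidableEquality V) {E : Rel V 0ℓ} (E? : Binary.Decidable E)
             (E-sym : Symmetric E)
             (K₄-free : ∀ {a b c d} → E a b → E a c → E a d → E b c → E b d → E c d → ⊥) where

  open Degrees E?

  -- The vertices of a maximal clique through a, which by K₄-freeness has at most three.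
  record Blocker (S : List V) (a : V) : Set where
    field
      vertices : List V
      size≤3   : length vertices ≤ 3
      ⊆S       : All (_∈ S) vertices
      ∋a       : a ∈ vertices
      blocks   : ∀ {u} → u ∈ S → Any (λ c → ¬ E u c) vertices

  blocker : ∀ S {a} → a ∈ S → Blocker S a
  blocker S {a} a∈S with Any.any? (E? a) S
  ... | no ¬ab = record
    { vertices = a ∷ [] ; size≤3 = s≤s z≤n ; ⊆S = a∈S ∷ [] ; ∋a = here refl
    ; blocks = λ u∈S → here (λ ua → ¬ab (lose u∈S (E-sym ua))) }
  ... | yes ab with find ab
  ...   | b , b∈S , ab′ with Any.any? (λ c → E? a c ×-dec E? b c) S
  ...     | no ¬abc = record
    { vertices = a ∷ b ∷ [] ; size≤3 = s≤s (s≤s z≤n) ; ⊆S = a∈S ∷ b∈S ∷ [] ; ∋a = here refl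
    ; blocks = blocks }
    where
    blocks : ∀ {u} → u ∈ S → Any (λ c → ¬ E u c) (a ∷ b ∷ [])
    blocks {u} u∈S with E? u a | E? u b
    ... | no ¬ua | _      = here ¬ua
    ... | yes _  | no ¬ub = there (here ¬ub)
    ... | yes ua | yes ub = ⊥-elim (¬abc (lose u∈S (E-sym ua , E-sym ub)))
  ...     | yes abc with find abc
  ...       | c , c∈S , (ac , bc) = record
    { vertices = a ∷ b ∷ c ∷ [] ; size≤3 = s≤s (s≤s (s≤s z≤n)) ; ⊆S = a∈S ∷ b∈S ∷ c∈S ∷ []
    ; ∋a = here refl ; blocks = blocks }
    where
    blocks : ∀ {u} → u ∈ S → Any (λ c → ¬ E u c) (a ∷ b ∷ c ∷ [])
    blocks {u} u∈S with E? u a | E? u b | E? u c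
    ... | no ¬ua | _      | _      = here ¬ua
    ... | yes _  | no ¬ub | _      = there (here ¬ub)
    ... | yes _  | yes _  | no ¬uc = there (there (here ¬uc))
    ... | yes ua | yes ub | yes uc = ⊥-elim (K₄-free ua ub uc ab′ ac bc)

  turán : ∀ {S} → Unique S → 3 * degreeSum S S ≤ 2 * (length S * length S)
  turán {S} = go S (<-wellFounded (length S))
    where
    go : ∀ S → Acc _<_ (length S) → Unique S → 3 * degreeSum S S ≤ 2 * (length S * length S)
    go []         _         _  = z≤n
    go S@(_ ∷ _) (acc rec) uS = begin
      3 * degreeSum S S                                 ≡⟨ cong (3 *_) (degreeSum-filter E-sym inC? S) ⟩
      3 * (degreeSum C C + 2 * degreeSum R C + degreeSum R R)
        ≤⟨ turán-step 1≤∣C∣ ∣C∣≤3 (degreeSum-≤ (All.tabulate (blocked ∘ ⊆S-of inC?)))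
                                  (degreeSum-≤ (All.tabulate (blocked ∘ ⊆S-of (∁? inC?))))
                                  (go R (rec ∣R∣<∣S∣) (Unique.filter⁺ (∁? inC?) uS)) ⟩
      2 * ((length C + length R) * (length C + length R)) ≡⟨ cong (λ m → 2 * (m * m)) ∣S∣≡∣C∣+∣R∣ ⟨
      2 * (length S * length S)                         ∎
      where
      open ≤-Reasoning
      open Blocker (blocker S (here refl))
      inC? : Decidable (_∈ vertices)
      inC? v = _∈?_ _≟_ v vertices
      C = filter inC? S
      R = filter (∁? inC?) S
      ∣S∣≡∣C∣+∣R∣ : length S ≡ length C + length R
      ∣S∣≡∣C∣+∣R∣ = length-filter-∁ inC? S
      ⊆S-of : ∀ {P : Pred V 0ℓ} (P? : Decidable P) {v} → v ∈ filter P? S → v ∈ S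
      ⊆S-of P? = proj₁ ∘ ∈-filter⁻ P?
      blocked : ∀ {u} → u ∈ S → Any (λ c → ¬ E u c) C
      blocked u∈S with find (blocks u∈S)
      ... | c , c∈vertices , ¬uc = lose (∈-filter⁺ inC? (All.lookup ⊆S c∈vertices) c∈vertices) ¬uc
      1≤∣C∣ : 1 ≤ length C
      1≤∣C∣ = filter-some inC? (here ∋a)
      ∣C∣≤3 : length C ≤ 3
      ∣C∣≤3 = ≤-trans (unique-⊆⇒length≤ _≟_ (Unique.filter⁺ inC? uS) (proj₂ ∘ ∈-filter⁻ inC?)) size≤3
      ∣R∣<∣S∣ : length R < length S
      ∣R∣<∣S∣ = ≤-trans (+-monoˡ-≤ (length R) 1≤∣C∣) (≤-reflexive (sym ∣S∣≡∣C∣+∣R∣))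

-- colour m = m mod 3, by a recursion that makes colour (3 + m) ≡ colour m hold definitionally
colour : ℕ → Fin 3
colour 0                   = Fin.zero
colour 1                   = Fin.suc Fin.zero
colour 2                   = Fin.suc (Fin.suc Fin.zero)
colour (suc (suc (suc m))) = colour m

colour-1+-≢ : ∀ m → colour (1 + m) ≢ colour m
colour-1+-≢ 0 ()
colour-1+-≢ 1 ()
colour-1+-≢ 2 ()
colour-1+-≢ (suc (suc (suc m))) = colour-1+-≢ m

colour-2+-≢ : ∀ m → colour (2 + m) ≢ colour m
colour-2+-≢ 0 ()
colour-2+-≢ 1 ()
colour-2+-≢ 2 ()
colour-2+-≢ (suc (suc (suc m))) = colour-2+-≢ m

differs? : ∀ c i → Dec (colour i ≢ c)
differs? c i = ¬? (colour i ≟ᶠ c)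

differently-coloured-below : ∀ m → 2 * m ≤ 3 * count (differs? (colour m)) (downFrom m)
differently-coloured-below 0 = z≤n
differently-coloured-below 1 = s≤s (s≤s z≤n)
differently-coloured-below 2 = s≤s (s≤s (s≤s (s≤s z≤n)))
differently-coloured-below (suc (suc (suc m))) = begin
  2 * (3 + m)            ≡⟨ *-distribˡ-+ 2 3 m ⟩
  6 + 2 * m              ≤⟨ +-monoʳ-≤ 6 (differently-coloured-below m) ⟩
  6 + 3 * below m        ≡⟨ *-distribˡ-+ 3 2 (below m) ⟨
  3 * (2 + below m)      ≡⟨ cong (3 *_) three-more ⟨
  3 * below (3 + m)      ∎
  where
  open ≤-Reasoning
  below : ℕ → ℕ
  below k = count (differs? (colour m)) (downFrom k)
  three-more : below (3 + m) ≡ 2 + below m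
  three-more rewrite indicator-yes (differs? (colour m) (2 + m)) (colour-2+-≢ m)
                   | indicator-yes (differs? (colour m) (1 + m)) (colour-1+-≢ m)
                   | indicator-no  (differs? (colour m) m) (λ c≢c → c≢c refl) = refl

square-step : ∀ j a b → 2 * j ≤ 3 * a → j * j ≤ 3 * b + j → suc j * suc j ≤ 3 * (a + b) + suc j
square-step j a b 2j≤3a j²≤3b+j = begin
  suc j * suc j                ≡⟨ expand j ⟩
  j * j + (2 * j + 1)          ≤⟨ +-mono-≤ j²≤3b+j (+-monoˡ-≤ 1 2j≤3a) ⟩
  3 * b + j + (3 * a + 1)      ≡⟨ regroup j a b ⟩
  3 * (a + b) + suc j          ∎
  where
  open ≤-Reasoning
  expand : ∀ j → suc j * suc j ≡ j * j + (2 * j + 1)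
  expand = solve-∀
  regroup : ∀ j a b → 3 * b + j + (3 * a + 1) ≡ 3 * (a + b) + suc j
  regroup = solve-∀

pairs-meet : ∀ {p q r s : Fin 3} → p ≢ q → r ≢ s → ∃[ c ] ((c ≡ p ⊎ c ≡ q) × (c ≡ r ⊎ c ≡ s))
pairs-meet {p} {q} {r} {s} p≢q r≢s with r ≟ᶠ p | r ≟ᶠ q | s ≟ᶠ p | s ≟ᶠ q
... | yes r≡p | _       | _       | _       = r , inj₁ r≡p , inj₁ refl
... | no _    | yes r≡q | _       | _       = r , inj₂ r≡q , inj₁ refl
... | no _    | no _    | yes s≡p | _       = s , inj₁ s≡p , inj₂ refl
... | no _    | no _    | no _    | yes s≡q = s , inj₂ s≡q , inj₂ refl
... | no r≢p  | no r≢q  | no s≢p  | no s≢q  =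
  ⊥-elim (4≰3 (unique-⊆⇒length≤ _≟ᶠ_ distinct (λ {v} _ → ∈-allFin v)))
  where
  distinct : Unique (p ∷ q ∷ r ∷ s ∷ [])
  distinct = (p≢q ∷ ≢-sym r≢p ∷ ≢-sym s≢p ∷ []) ∷ (≢-sym r≢q ∷ ≢-sym s≢q ∷ []) ∷ (r≢s ∷ []) ∷ [] ∷ []
  4≰3 : ¬ 4 ≤ 3
  4≰3 (s≤s (s≤s (s≤s ())))

module LineGraph (n : ℕ) where

  open Graph (LKAdj n)

  infix 4 _∈ₑ_
  _∈ₑ_ : Fin n → LKVertex n → Set
  v ∈ₑ ((a , b) , _) = v ≡ a ⊎ v ≡ b

  Share : LKVertex n → LKVertex n → Set
  Share x y = ∃[ v ] (v ∈ₑ x × v ∈ₑ y)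

  vertex-≡ : ∀ {x y : LKVertex n} → proj₁ x ≡ proj₁ y → x ≡ y
  vertex-≡ {_ , a<b} {_ , a<b′} refl = cong (_ ,_) (<-irrelevant a<b a<b′)

  _≟ᵥ_ : DecidableEquality (LKVertex n)
  x ≟ᵥ y = map′ vertex-≡ (cong proj₁) (Product.≡-dec _≟ᶠ_ _≟ᶠ_ (proj₁ x) (proj₁ y))

  module _ {x y : LKVertex n} where

    private
      SharedPair = let ((a , b) , _) = x ; ((c , d) , _) = y in a ≡ c ⊎ a ≡ d ⊎ b ≡ c ⊎ b ≡ d

    share⇒sharedPair : Share x y → SharedPair
    share⇒sharedPair (_ , inj₁ refl , inj₁ refl) = inj₁ refl
    share⇒sharedPair (_ , inj₁ refl , inj₂ refl) = inj₂ (inj₁ refl)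
    share⇒sharedPair (_ , inj₂ refl , inj₁ refl) = inj₂ (inj₂ (inj₁ refl))
    share⇒sharedPair (_ , inj₂ refl , inj₂ refl) = inj₂ (inj₂ (inj₂ refl))

    sharedPair⇒share : SharedPair → Share x y
    sharedPair⇒share (inj₁ refl)               = _ , inj₁ refl , inj₁ refl
    sharedPair⇒share (inj₂ (inj₁ refl))        = _ , inj₁ refl , inj₂ refl
    sharedPair⇒share (inj₂ (inj₂ (inj₁ refl))) = _ , inj₂ refl , inj₁ refl
    sharedPair⇒share (inj₂ (inj₂ (inj₂ refl))) = _ , inj₂ refl , inj₂ refl

    share? : Dec (Share x y)
    share? = let ((a , b) , _) = x ; ((c , d) , _) = y in
      map′ sharedPair⇒share share⇒sharedPair ((a ≟ᶠ c) ⊎-dec (a ≟ᶠ d) ⊎-dec (b ≟ᶠ c) ⊎-dec (b ≟ᶠ d))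

    adj⇒share : LKAdj n x y → Share x y
    adj⇒share (_ , shared) = sharedPair⇒share shared

    share⇒adj : x ≢ y → Share x y → LKAdj n x y
    share⇒adj x≢y s = x≢y ∘ vertex-≡ , share⇒sharedPair s

  ordered : ∀ {p q} (x : LKVertex n) → proj₁ x ≡ (p , q) → toℕ p < toℕ q
  ordered (_ , p<q) refl = p<q

  endpoints : ∀ {p q} (x : LKVertex n) → p ≢ q → p ∈ₑ x → q ∈ₑ x → proj₁ x ≡ (p , q) ⊎ proj₁ x ≡ (q , p)
  endpoints _ p≢q (inj₁ refl) (inj₁ refl) = ⊥-elim (p≢q refl)
  endpoints _ p≢q (inj₁ refl) (inj₂ refl) = inj₁ refl
  endpoints _ p≢q (inj₂ refl) (inj₁ refl) = inj₂ refl
  endpoints _ p≢q (inj₂ refl) (inj₂ refl) = ⊥-elim (p≢q refl)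

  ∈ₑ-endpoints : ∀ {p q v} (x : LKVertex n) → p ≢ q → p ∈ₑ x → q ∈ₑ x → v ∈ₑ x → v ≡ p ⊎ v ≡ q
  ∈ₑ-endpoints x p≢q p∈x q∈x v∈x with endpoints x p≢q p∈x q∈x | v∈x
  ... | inj₁ refl | v∈ = v∈
  ... | inj₂ refl | v∈ = Sum.swap v∈

  ≡-by-endpoints : ∀ {p q} (x y : LKVertex n) → p ≢ q → p ∈ₑ x → q ∈ₑ x → p ∈ₑ y → q ∈ₑ y → x ≡ y
  ≡-by-endpoints x y p≢q p∈x q∈x p∈y q∈y with endpoints x p≢q p∈x q∈x | endpoints y p≢q p∈y q∈y
  ... | inj₁ ex | inj₁ ey = vertex-≡ (trans ex (sym ey))
  ... | inj₂ ex | inj₂ ey = vertex-≡ (trans ex (sym ey))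
  ... | inj₁ ex | inj₂ ey = ⊥-elim (<-asym (ordered x ex) (ordered y ey))
  ... | inj₂ ex | inj₁ ey = ⊥-elim (<-asym (ordered x ex) (ordered y ey))

  join : ∀ {p q} → p ≢ q → ∃[ w ] (p ∈ₑ w × q ∈ₑ w)
  join {p} {q} p≢q with <-cmp (toℕ p) (toℕ q)
  ... | tri< p<q _ _ = ((p , q) , p<q) , inj₁ refl , inj₂ refl
  ... | tri≈ _ p≡q _ = ⊥-elim (p≢q (toℕ-injective p≡q))
  ... | tri> _ _ q<p = ((q , p) , q<p) , inj₂ refl , inj₁ refl

  ¬share⇒ends-≢ : ∀ {x y u v} → ¬ Share x y → u ∈ₑ x → v ∈ₑ y → u ≢ v
  ¬share⇒ends-≢ {u = u} ¬xy u∈x v∈y refl = ¬xy (u , u∈x , v∈y)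

  ≢⇒1≤len : ∀ {x y} → x ≢ y → (p : Walk x y) → 1 ≤ len p
  ≢⇒1≤len x≢y nil        = ⊥-elim (x≢y refl)
  ≢⇒1≤len x≢y (cons _ _) = s≤s z≤n

  ¬share⇒2≤len : ∀ {x y} → ¬ Share x y → (p : Walk x y) → 2 ≤ len p
  ¬share⇒2≤len ¬xy nil                 = ⊥-elim (¬xy (_ , inj₁ refl , inj₁ refl))
  ¬share⇒2≤len {x} {y} ¬xy (cons xy nil) = ⊥-elim (¬xy (adj⇒share {x} {y} xy))
  ¬share⇒2≤len ¬xy (cons _ (cons _ _)) = s≤s (s≤s z≤n)

  bridge : ∀ {x y p q} → ¬ Share x y → p ∈ₑ x → q ∈ₑ y → (w : LKVertex n) → p ∈ₑ w → q ∈ₑ w → Walk x y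
  bridge {x} {y} {p} {q} ¬xy p∈x q∈y w p∈w q∈w =
    cons {w = w} (share⇒adj {x} {w} x≢w (p , p∈x , p∈w)) (cons (share⇒adj {w} {y} w≢y (q , q∈w , q∈y)) nil)
    where
    x≢w : x ≢ w
    x≢w refl = ¬xy (q , q∈w , q∈y)
    w≢y : w ≢ y
    w≢y refl = ¬xy (p , p∈x , p∈w)

  shortest-middle : ∀ {x y} → ¬ Share x y → (p : Walk x y) → IsShortest p →
                    ∃[ w ] (w ∈ internal p × Share x w × Share w y)
  shortest-middle {x} {y} ¬xy p shortest = middle p (¬share⇒2≤len ¬xy p) (shortest viaJoin)
    where
    viaJoin : Walk x y
    viaJoin with join {proj₁ (proj₁ x)} {proj₁ (proj₁ y)} (λ a≡c → ¬xy (_ , inj₁ refl , inj₁ a≡c))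
    ... | w , a∈w , c∈w = bridge ¬xy (inj₁ refl) (inj₁ refl) w a∈w c∈w
    middle : (p : Walk x y) → 2 ≤ len p → len p ≤ 2 → ∃[ w ] (w ∈ internal p × Share x w × Share w y)
    middle (cons {w = w} xw (cons wy nil)) _ _ = w , here refl , adj⇒share {x} {w} xw , adj⇒share {w} {y} wy
    middle (cons _ nil)                   (s≤s ()) _
    middle (cons _ (cons _ (cons _ _)))   _        (s≤s (s≤s ()))

  module _ (X : List (LKVertex n)) where

    Linked : Rel (Fin n) 0ℓ
    Linked a b = a ≢ b × Any (λ x → a ∈ₑ x × b ∈ₑ x) X

    linked? : Binary.Decidable Linked
    linked? a b = ¬? (a ≟ᶠ b) ×-dec Any.any? (λ x → ∈ₑ? a x ×-dec ∈ₑ? b x) X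
      where
      ∈ₑ? : ∀ v x → Dec (v ∈ₑ x)
      ∈ₑ? v ((a , b) , _) = (v ≟ᶠ a) ⊎-dec (v ≟ᶠ b)

    linked-sym : Symmetric Linked
    linked-sym (a≢b , ab∈X) = (a≢b ∘ sym) , Any.map swap ab∈X

    linked-across-invisible : MutualVisibility X → ∀ {x y} → x ∈ X → y ∈ X →
                              (∀ {u v} → u ∈ₑ x → v ∈ₑ y → Linked u v) → ⊥
    linked-across-invisible (_ , visible) {x} {y} x∈X y∈X linked
      with visible x∈X y∈X
    ... | p , shortest , outside
      with shortest-middle (λ (v , v∈x , v∈y) → proj₁ (linked v∈x v∈y) refl) p shortest
    ... | w , w∈p , (u , u∈x , u∈w) , (v , v∈w , v∈y)
      with linked u∈x v∈y
    ... | u≢v , uv∈X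
      with find uv∈X
    ... | z , z∈X , u∈z , v∈z =
      All.lookup outside w∈p (subst (_∈ X) (≡-by-endpoints z w u≢v u∈z v∈z u∈w v∈w) z∈X)

    linked-K₄-free : MutualVisibility X →
                     ∀ {a b c d} → Linked a b → Linked a c → Linked a d → Linked b c → Linked b d → Linked c d → ⊥
    linked-K₄-free mv {a} {b} {c} {d} (a≢b , ab∈X) ac ad bc bd (c≢d , cd∈X)
      with find ab∈X | find cd∈X
    ... | x , x∈X , a∈x , b∈x | y , y∈X , c∈y , d∈y = linked-across-invisible mv x∈X y∈X linked
      where
      cross : ∀ {u v} → u ≡ a ⊎ u ≡ b → v ≡ c ⊎ v ≡ d → Linked u v
      cross (inj₁ refl) (inj₁ refl) = ac
      cross (inj₁ refl) (inj₂ refl) = ad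
      cross (inj₂ refl) (inj₁ refl) = bc
      cross (inj₂ refl) (inj₂ refl) = bd
      linked : ∀ {u v} → u ∈ₑ x → v ∈ₑ y → Linked u v
      linked u∈x v∈y = cross (∈ₑ-endpoints x a≢b a∈x b∈x u∈x) (∈ₑ-endpoints y c≢d c∈y d∈y v∈y)

    orientations : List (Fin n × Fin n)
    orientations = map proj₁ X ++ map (swap ∘ proj₁) X

    length-orientations : length orientations ≡ 2 * length X
    length-orientations = begin
      length (map proj₁ X ++ map (swap ∘ proj₁) X)          ≡⟨ length-++ (map proj₁ X) ⟩
      length (map proj₁ X) + length (map (swap ∘ proj₁) X) ≡⟨ cong₂ _+_ (length-map proj₁ X)
                                                                       (length-map (swap ∘ proj₁) X) ⟩
      length X + length X                                  ≡⟨ cong (length X +_) (+-identityʳ (length X)) ⟨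
      2 * length X                                         ∎
      where open ≡-Reasoning

    orientations-unique : Unique X → Unique orientations
    orientations-unique uX =
      Unique.++⁺ (Unique.map⁺ vertex-≡ uX) (Unique.map⁺ (vertex-≡ ∘ cong swap) uX) opposite
      where
      opposite : Disjoint (map proj₁ X) (map (swap ∘ proj₁) X)
      opposite (v∈ , v∈′) with ∈-map⁻ proj₁ v∈ | ∈-map⁻ (swap ∘ proj₁) v∈′
      ... | x , _ , refl | y , _ , x≡y˘ = <-asym (ordered x refl) (ordered y (cong swap (sym x≡y˘)))

    orientations-linked : All (λ (a , b) → Linked a b) orientations
    orientations-linked = All.++⁺ (All.map⁺ (All.tabulate linked-ends))
                                  (All.map⁺ (All.tabulate (linked-sym ∘ linked-ends)))
      where
      linked-ends : ∀ {x} → x ∈ X → Linked (proj₁ (proj₁ x)) (proj₂ (proj₁ x))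
      linked-ends {_ , a<b} x∈X = (λ a≡b → <-irrefl (cong toℕ a≡b) a<b) , lose x∈X (inj₁ refl , inj₂ refl)

    mutualVisibility-≤ : MutualVisibility X → 6 * length X ≤ 2 * (n * n)
    mutualVisibility-≤ mv@(uX , _) = begin
      6 * length X                                ≡⟨ *-assoc 3 2 (length X) ⟩
      3 * (2 * length X)                          ≡⟨ cong (3 *_) length-orientations ⟨
      3 * length orientations                     ≤⟨ *-monoʳ-≤ 3 (unique-arcs-length≤ _≟ᶠ_ ∈-allFin
                                                                    (orientations-unique uX) orientations-linked) ⟩
      3 * degreeSum (allFin n) (allFin n)         ≤⟨ turán (Unique.allFin⁺ n) ⟩
      2 * (length (allFin n) * length (allFin n)) ≡⟨ cong (λ m → 2 * (m * m)) (length-tabulate {n = n} id) ⟩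
      2 * (n * n)                                 ∎
      where
      open ≤-Reasoning
      open Degrees linked?
      open Turán _≟ᶠ_ linked? linked-sym (linked-K₄-free mv)

  Bichromatic : (Fin n → Fin 3) → LKVertex n → Set
  Bichromatic κ ((a , b) , _) = κ a ≢ κ b

  module _ (κ : Fin n → Fin 3) where

    bichromatic-ends : ∀ w {p q} → Bichromatic κ w → p ≢ q → p ∈ₑ w → q ∈ₑ w → κ p ≢ κ q
    bichromatic-ends w@((a , b) , _) κa≢κb p≢q p∈w q∈w with endpoints w p≢q p∈w q∈w
    ... | inj₁ refl = κa≢κb
    ... | inj₂ refl = κa≢κb ∘ sym

    same-coloured-ends : ∀ {x y} → Bichromatic κ x → Bichromatic κ y → ∃₂ λ u v → u ∈ₑ x × v ∈ₑ y × κ u ≡ κ v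
    same-coloured-ends {(a , b) , _} {(c , d) , _} κa≢κb κc≢κd with pairs-meet κa≢κb κc≢κd
    ... | _ , inj₁ refl , inj₁ κa≡κc = a , c , inj₁ refl , inj₁ refl , κa≡κc
    ... | _ , inj₁ refl , inj₂ κa≡κd = a , d , inj₁ refl , inj₂ refl , κa≡κd
    ... | _ , inj₂ refl , inj₁ κb≡κc = b , c , inj₂ refl , inj₁ refl , κb≡κc
    ... | _ , inj₂ refl , inj₂ κb≡κd = b , d , inj₂ refl , inj₂ refl , κb≡κd

    module _ {X : List (LKVertex n)} (bichromatic : All (Bichromatic κ) X) where

      visible-via-monochromatic : ∀ {x y u v} → ¬ Share x y → u ∈ₑ x → v ∈ₑ y → κ u ≡ κ v → Visible X x y
      visible-via-monochromatic {x} {y} ¬xy u∈x v∈y κu≡κv with join (¬share⇒ends-≢ {x} {y} ¬xy u∈x v∈y)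
      ... | w , u∈w , v∈w = bridge ¬xy u∈x v∈y w u∈w v∈w , ¬share⇒2≤len ¬xy , (w∉X ∷ [])
        where
        w∉X : w ∉ X
        w∉X w∈X = bichromatic-ends w (All.lookup bichromatic w∈X) (¬share⇒ends-≢ {x} {y} ¬xy u∈x v∈y) u∈w v∈w κu≡κv

      bichromatic-mutualVisibility : Unique X → MutualVisibility X
      bichromatic-mutualVisibility uX = uX , visible
        where
        visible : ∀ {x y} → x ∈ X → y ∈ X → Visible X x y
        visible {x} {y} x∈X y∈X with x ≟ᵥ y | share? {x} {y}
        ... | yes refl | _      = nil , (λ _ → z≤n) , []
        ... | no x≢y   | yes xy = cons (share⇒adj {x} {y} x≢y xy) nil , ≢⇒1≤len x≢y , []
        ... | no _     | no ¬xy
          with same-coloured-ends {x} {y} (All.lookup bichromatic x∈X) (All.lookup bichromatic y∈X)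
        ...   | u , v , u∈x , v∈y , κu≡κv = visible-via-monochromatic ¬xy u∈x v∈y κu≡κv

  mod3 : Fin n → Fin 3
  mod3 = colour ∘ toℕ

  module _ {j} (j<n : j < n) where

    edge : ∀ {i} → i < j → LKVertex n
    edge {i} i<j = (fromℕ< (<-trans i<j j<n) , fromℕ< j<n) ,
                   subst₂ _<_ (sym (toℕ-fromℕ< _)) (sym (toℕ-fromℕ< j<n)) i<j

    edge-bichromatic : ∀ {i} (i<j : i < j) → colour i ≢ colour j → Bichromatic mod3 (edge i<j)
    edge-bichromatic i<j =
      subst₂ (λ a b → colour a ≢ colour b) (sym (toℕ-fromℕ< (<-trans i<j j<n))) (sym (toℕ-fromℕ< j<n))

    row : (m : ℕ) → m ≤ j → List (LKVertex n)
    row zero    _   = []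
    row (suc i) i<j with colour i ≟ᶠ colour j
    ... | yes _ = row i (<⇒≤ i<j)
    ... | no  _ = edge i<j ∷ row i (<⇒≤ i<j)

    row-bichromatic : ∀ m m≤j → All (Bichromatic mod3) (row m m≤j)
    row-bichromatic zero    _   = []
    row-bichromatic (suc i) i<j with colour i ≟ᶠ colour j
    ... | yes _  = row-bichromatic i (<⇒≤ i<j)
    ... | no  ci≢cj = edge-bichromatic i<j ci≢cj ∷ row-bichromatic i (<⇒≤ i<j)

    row-ends : ∀ m m≤j → All (λ x → toℕ (proj₂ (proj₁ x)) ≡ j × toℕ (proj₁ (proj₁ x)) < m) (row m m≤j)
    row-ends zero    _   = []
    row-ends (suc i) i<j with colour i ≟ᶠ colour j
    ... | yes _ = All.map (map₂ m≤n⇒m≤1+n) (row-ends i (<⇒≤ i<j))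
    ... | no  _ = (toℕ-fromℕ< j<n , ≤-reflexive (cong suc (toℕ-fromℕ< _)))
                  ∷ All.map (map₂ m≤n⇒m≤1+n) (row-ends i (<⇒≤ i<j))

    row-unique : ∀ m m≤j → Unique (row m m≤j)
    row-unique zero    _   = []
    row-unique (suc i) i<j with colour i ≟ᶠ colour j
    ... | yes _ = row-unique i (<⇒≤ i<j)
    ... | no  _ = All.map (edge-≢ i<j ∘ proj₂) (row-ends i (<⇒≤ i<j)) ∷ row-unique i (<⇒≤ i<j)
      where
      edge-≢ : ∀ {i} (i<j : i < j) {x} → toℕ (proj₁ (proj₁ x)) < i → edge i<j ≢ x
      edge-≢ i<j x₁<i refl = <-irrefl (toℕ-fromℕ< _) x₁<i

    length-row : ∀ m m≤j → length (row m m≤j) ≡ count (differs? (colour j)) (downFrom m)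
    length-row zero    _   = refl
    length-row (suc i) i<j with colour i ≟ᶠ colour j
    ... | yes _ = length-row i (<⇒≤ i<j)
    ... | no  _ = cong suc (length-row i (<⇒≤ i<j))

  rows : (j : ℕ) → j ≤ n → List (LKVertex n)
  rows zero    _   = []
  rows (suc j) j<n = row j<n j ≤-refl ++ rows j (<⇒≤ j<n)

  rows-bichromatic : ∀ j j≤n → All (Bichromatic mod3) (rows j j≤n)
  rows-bichromatic zero    _   = []
  rows-bichromatic (suc j) j<n = All.++⁺ (row-bichromatic j<n j ≤-refl) (rows-bichromatic j (<⇒≤ j<n))

  rows-below : ∀ j j≤n → All (λ x → toℕ (proj₂ (proj₁ x)) < j) (rows j j≤n)
  rows-below zero    _   = []
  rows-below (suc j) j<n = All.++⁺ (All.map (≤-reflexive ∘ cong suc ∘ proj₁) (row-ends j<n j ≤-refl))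
                                   (All.map m<n⇒m<1+n (rows-below j (<⇒≤ j<n)))

  rows-unique : ∀ j j≤n → Unique (rows j j≤n)
  rows-unique zero    _   = []
  rows-unique (suc j) j<n = Unique.++⁺ (row-unique j<n j ≤-refl) (rows-unique j (<⇒≤ j<n)) earlier-rows
    where
    earlier-rows : Disjoint (row j<n j ≤-refl) (rows j (<⇒≤ j<n))
    earlier-rows (x∈row , x∈rows) =
      <-irrefl (proj₁ (All.lookup (row-ends j<n j ≤-refl) x∈row)) (All.lookup (rows-below j (<⇒≤ j<n)) x∈rows)

  rows-length : ∀ j j≤n → j * j ≤ 3 * length (rows j j≤n) + j
  rows-length zero    _   = z≤n
  rows-length (suc j) j<n = begin
    suc j * suc j                         ≤⟨ square-step j ∣row∣ ∣rows∣ 2j≤3∣row∣ (rows-length j (<⇒≤ j<n)) ⟩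
    3 * (∣row∣ + ∣rows∣) + suc j          ≡⟨ cong (λ m → 3 * m + suc j) (length-++ (row j<n j ≤-refl)) ⟨
    3 * length (rows (suc j) j<n) + suc j ∎
    where
    open ≤-Reasoning
    ∣row∣ = length (row j<n j ≤-refl)
    ∣rows∣ = length (rows j (<⇒≤ j<n))
    2j≤3∣row∣ : 2 * j ≤ 3 * ∣row∣
    2j≤3∣row∣ = subst (λ m → 2 * j ≤ 3 * m) (sym (length-row j<n j ≤-refl)) (differently-coloured-below j)

  large-mutualVisibility : ∃[ X ] (MutualVisibility X × n * n ≤ 3 * length X + n)
  large-mutualVisibility = rows n ≤-refl
                         , bichromatic-mutualVisibility mod3 (rows-bichromatic n ≤-refl) (rows-unique n ≤-refl)
                         , rows-length n ≤-refl

lower-scaled : ∀ k n L → k ≤ n → n * n ≤ 3 * L + n → 2 * k * (n * n) ≤ 6 * k * L + 3 * (n * n)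
lower-scaled k n L k≤n n²≤3L+n = begin
  2 * k * (n * n)           ≤⟨ *-monoʳ-≤ (2 * k) n²≤3L+n ⟩
  2 * k * (3 * L + n)       ≡⟨ distrib k n L ⟩
  6 * k * L + 2 * (k * n)   ≤⟨ +-monoʳ-≤ (6 * k * L) (*-monoʳ-≤ 2 (*-monoˡ-≤ n k≤n)) ⟩
  6 * k * L + 2 * (n * n)   ≤⟨ +-monoʳ-≤ (6 * k * L) (*-monoˡ-≤ (n * n) (n≤1+n 2)) ⟩
  6 * k * L + 3 * (n * n)   ∎
  where
  open ≤-Reasoning
  distrib : ∀ k n L → 2 * k * (3 * L + n) ≡ 6 * k * L + 2 * (k * n)
  distrib = solve-∀

upper-scaled : ∀ k n x → 6 * x ≤ 2 * (n * n) → 6 * k * x ≤ 2 * k * (n * n) + 3 * (n * n)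
upper-scaled k n x 6x≤2n² = begin
  6 * k * x                 ≡⟨ reassoc k x ⟩
  k * (6 * x)               ≤⟨ *-monoʳ-≤ k 6x≤2n² ⟩
  k * (2 * (n * n))         ≡⟨ reassoc′ k n ⟩
  2 * k * (n * n)           ≤⟨ m≤m+n _ _ ⟩
  2 * k * (n * n) + 3 * (n * n) ∎
  where
  open ≤-Reasoning
  reassoc : ∀ k x → 6 * k * x ≡ k * (6 * x)
  reassoc = solve-∀
  reassoc′ : ∀ k n → k * (2 * (n * n)) ≡ 2 * k * (n * n)
  reassoc′ = solve-∀

-- N = k suffices.
corollary3p3 : ∀ (k : ℕ) → 1 ≤ k → ∃[ N ] (∀ (n : ℕ) → N ≤ n → 3 ≤ n →
    (∃[ X ] (MutVisLK n X × 2 * k * (n * n) ≤ 6 * k * length X + 3 * (n * n)))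
    × (∀ X → MutVisLK n X → 6 * k * length X ≤ 2 * k * (n * n) + 3 * (n * n)))
corollary3p3 k _ = k , λ n k≤n _ →
  let open LineGraph n
      X , mvX , n²≤3∣X∣+n = large-mutualVisibility
  in (X , mvX , lower-scaled k n (length X) k≤n n²≤3∣X∣+n) ,
     λ Y mvY → upper-scaled k n (length Y) (mutualVisibility-≤ Y mvY)
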